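{- Let $k\ge 2$ and $t\ge \log_2 k$ be integers. Then there exists a $(k,t,\lceil \tfrac{33}{10}t^2 2^t\rceil)$-full oriented graph.
   Context: For an oriented graph $K$ with vertices ordered in a fixed way, a vertex $v$ and a set $A=\{u_1,\dots,u_{|A|}\}$ of neighbours of $v$ (in that order), $F(A,v,K)\in\{ -1,1\}^{|A|}$ has $i$-th entry $1$ if $(v,u_i)$ is an arc and $-1$ if $(u_i,v)$ is an arc. An orientation $K$ of the complete $k$-partite graph with parts $P_1,\dots,P_k$ each of size $N$ is $(k,t,N)$-full if for every $i\in\{1,\dots,k\}$, every $A\subseteq\bigcup_{j\ne i}P_j$ with $|A|\le t$ and every $\vec a\in\{ -1,1\}^{|A|}$, there is a vertex $v\in P_i$ with $F(A,v,K)=\vec a$. -}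

module Defs where

open import Data.Nat using (ℕ; _+_; _*_; _^_; _≤_)
open import Data.Nat.DivMod using (_/_)
open import Data.Fin using (Fin)
open import Data.Bool using (Bool; true; false; not)
open import Data.Product using (_×_; _,_; proj₁; ∃-syntax)
open import Data.List using (List; map; length)
open import Data.List.Relation.Unary.All using (All)
open import Data.List.Relation.Unary.Unique.Propositional using (Unique)
open import Relation.Binary.PropositionalEquality using (_≡_; _≢_)

-- Vertices of the complete k-partite graph with parts P_1..P_k of size N:
-- vertex (i , a) is the a-th vertex of part P_i.
Vertex : ℕ → ℕ → Set
Vertex k N = Fin k × Fin N

part : ∀ {k N} → Vertex k N → Fin k
part = proj₁

record Orientation (k N : ℕ) : Set where
  field
    arc      : Vertex k N → Vertex k N → Bool
    between  : ∀ u v → part u ≢ part v → arc u v ≡ not (arc v u)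
    inside   : ∀ u v → part u ≡ part v → arc u v ≡ false

open Orientation public

data Sign : Set where
  minus plus : Sign

sign : ∀ {k N} → Orientation k N → Vertex k N → Vertex k N → Sign
sign K v u with arc K v u
... | true  = plus
... | false = minus

F : ∀ {k N} → List (Vertex k N) → Vertex k N → Orientation k N → List Sign
F A v K = map (sign K v) A

Full : (k t N : ℕ) → Orientation k N → Set
Full k t N K =
  ∀ (i : Fin k) (A : List (Vertex k N)) →
  Unique A → All (λ u → part u ≢ i) A → length A ≤ t →
  ∀ (a : List Sign) → length a ≡ length A →
  ∃[ v ] (part v ≡ i × F A v K ≡ a)

⌈_/10⌉ : ℕ → ℕ
⌈ m /10⌉ = (m + 9) / 10

{-# OPTIONS --safe #-}
-- A counting version of the union bound over a uniformly random orientation.  A request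
-- (i, A, a) with |A| ≤ t is missed by a fixed vertex of P_i with probability 1 - 2^-|A|, independently
-- for the N vertices of P_i, so it stays unmet with probability at most (1 - 2^-t)^N ≤ 2^(-N/2^t),
-- which for N = ⌈3.3 t² 2^t⌉ is at most 2^(-3.3 t²).  As k ≤ 2^t there are at most
-- 2^t (t+1) (2^(t+1) N)^t requests, fewer than 2^(3.3 t²) for t ≥ 9 (the inequality is evaluated
-- directly for t < 9), so some orientation meets every request.

module Submission where

open import Data.Bool using (Bool; true; false; not; _∧_; _∨_; _xor_)
open import Data.Bool.Properties using (∧-conicalˡ; ∧-conicalʳ; ∨-conicalˡ; ∨-conicalʳ; xor-assoc; xor-comm; not-distribˡ-xor; not-injective)
open import Data.Empty using (⊥-elim)
open import Data.Fin using (Fin; zero; suc; toℕ; combine; remQuot) renaming (_≟_ to _≟ᶠ_)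
open import Data.Fin.Properties using (toℕ-injective; combine-injective; remQuot-combine)
open import Data.List using (List; []; _∷_; _++_; map; concatMap; length; allFin)
open import Data.List.Properties using (length-map; length-tabulate)
open import Data.List.Membership.Propositional using (_∈_)
open import Data.List.Membership.Propositional.Properties using (∈-map⁺; ∈-concat⁺′; ∈-allFin)
open import Data.List.Relation.Unary.All using (All; []; _∷_; all?)
open import Data.List.Relation.Unary.AllPairs using ([]; _∷_; allPairs?)
open import Data.List.Relation.Unary.Any using (here; there)
open import Data.List.Relation.Unary.Unique.Propositional using (Unique)
open import Data.List.Relation.Unary.Unique.Propositional.Properties using (map⁺)
open import Data.Maybe using (Maybe; just; nothing)
open import Data.Nat
open import Data.Nat.DivMod using (_%_; m≡m%n+[m/n]*n; m%n<n; m/n*n≤m; m≥n⇒m/n>0)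
open import Data.Nat.Logarithm using (⌈log₂_⌉; ⌈log₂⌉-mono-≤; ⌈log₂⌈n/2⌉⌉≡⌈log₂n⌉∸1)
open import Data.Nat.Properties
open import Data.Nat.Tactic.RingSolver using (solve-∀)
open import Data.Product using (∃-syntax; _,_; _×_; proj₁; proj₂)
open import Data.Product.Properties using (≡-dec)
open import Data.Vec using (Vec; []; _∷_; lookup; _[_]≔_; replicate)
open import Data.Vec.Properties using (lookup∘update; lookup∘update′; lookup-replicate)
open import Function using (_∘_; id)
open import Relation.Binary.PropositionalEquality
open import Relation.Nullary using (Dec; yes; no; does; ¬?; _×-dec_)
open import Relation.Nullary.Decidable using (dec-true)
open import Defs

private variable
  A B : Set
  m : ℕ

^-distribʳ-* : ∀ a b c → (a * b) ^ c ≡ a ^ c * b ^ c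
^-distribʳ-* a b zero    = refl
^-distribʳ-* a b (suc c) = begin
  a * b * (a * b) ^ c        ≡⟨ cong (a * b *_) (^-distribʳ-* a b c) ⟩
  a * b * (a ^ c * b ^ c)    ≡⟨ interchange a b (a ^ c) (b ^ c) ⟩
  a * a ^ c * (b * b ^ c)    ∎
  where
  open ≡-Reasoning
  interchange : ∀ a b x y → a * b * (x * y) ≡ a * x * (b * y)
  interchange = solve-∀

sumOver : (A → ℕ) → List A → ℕ
sumOver f []       = 0
sumOver f (x ∷ xs) = f x + sumOver f xs

ind : Bool → ℕ
ind true  = 1
ind false = 0

count : (A → Bool) → List A → ℕ
count P = sumOver (ind ∘ P)

vectors : (m : ℕ) → List A → List (Vec A m)
vectors zero    xs = [] ∷ []
vectors (suc m) xs = concatMap (λ a → map (a ∷_) (vectors m xs)) xs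

sumOver-++ : (f : A → ℕ) (xs ys : List A) → sumOver f (xs ++ ys) ≡ sumOver f xs + sumOver f ys
sumOver-++ f []       ys = refl
sumOver-++ f (x ∷ xs) ys = trans (cong (f x +_) (sumOver-++ f xs ys)) (sym (+-assoc (f x) _ _))

sumOver-map : (f : B → ℕ) (g : A → B) (xs : List A) → sumOver f (map g xs) ≡ sumOver (f ∘ g) xs
sumOver-map f g []       = refl
sumOver-map f g (x ∷ xs) = cong (f (g x) +_) (sumOver-map f g xs)

sumOver-concatMap : (f : B → ℕ) (g : A → List B) (xs : List A) →
  sumOver f (concatMap g xs) ≡ sumOver (sumOver f ∘ g) xs
sumOver-concatMap f g []       = refl
sumOver-concatMap f g (x ∷ xs) =
  trans (sumOver-++ f (g x) (concatMap g xs)) (cong (sumOver f (g x) +_) (sumOver-concatMap f g xs))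

sumOver-cong : {f g : A → ℕ} (xs : List A) → (∀ x → f x ≡ g x) → sumOver f xs ≡ sumOver g xs
sumOver-cong []       e = refl
sumOver-cong (x ∷ xs) e = cong₂ _+_ (e x) (sumOver-cong xs e)

sumOver-mono : {f g : A → ℕ} (xs : List A) → (∀ x → f x ≤ g x) → sumOver f xs ≤ sumOver g xs
sumOver-mono []       e = z≤n
sumOver-mono (x ∷ xs) e = +-mono-≤ (e x) (sumOver-mono xs e)

sumOver-const : (c : ℕ) (xs : List A) → sumOver (λ _ → c) xs ≡ length xs * c
sumOver-const c []       = refl
sumOver-const c (x ∷ xs) = cong (c +_) (sumOver-const c xs)

sumOver-*ˡ : (c : ℕ) (f : A → ℕ) (xs : List A) → sumOver (λ x → c * f x) xs ≡ c * sumOver f xs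
sumOver-*ˡ c f []       = sym (*-zeroʳ c)
sumOver-*ˡ c f (x ∷ xs) = trans (cong (c * f x +_) (sumOver-*ˡ c f xs)) (sym (*-distribˡ-+ c (f x) _))

sumOver-+ : (f g : A → ℕ) (xs : List A) →
  sumOver (λ x → f x + g x) xs ≡ sumOver f xs + sumOver g xs
sumOver-+ f g []       = refl
sumOver-+ f g (x ∷ xs) = begin
  f x + g x + sumOver (λ x → f x + g x) xs   ≡⟨ cong (f x + g x +_) (sumOver-+ f g xs) ⟩
  f x + g x + (sumOver f xs + sumOver g xs)  ≡⟨ +-cancel (f x) (g x) (sumOver f xs) (sumOver g xs) ⟩
  f x + sumOver f xs + (g x + sumOver g xs)  ∎
  where
  open ≡-Reasoning
  +-cancel : ∀ a b c d → a + b + (c + d) ≡ a + c + (b + d)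
  +-cancel = solve-∀

sumOver-comm : (g : A → B → ℕ) (xs : List A) (ys : List B) →
  sumOver (λ x → sumOver (g x) ys) xs ≡ sumOver (λ y → sumOver (λ x → g x y) xs) ys
sumOver-comm g []       ys = sym (trans (sumOver-const 0 ys) (*-zeroʳ (length ys)))
sumOver-comm g (x ∷ xs) ys =
  trans (cong (sumOver (g x) ys +_) (sumOver-comm g xs ys)) (sym (sumOver-+ (g x) _ ys))

length≡sumOver-1 : (xs : List A) → length xs ≡ sumOver (λ _ → 1) xs
length≡sumOver-1 xs = sym (trans (sumOver-const 1 xs) (*-identityʳ (length xs)))

length-concatMap : (g : A → List B) (xs : List A) → length (concatMap g xs) ≡ sumOver (length ∘ g) xs
length-concatMap g xs = begin
  length (concatMap g xs)                       ≡⟨ length≡sumOver-1 (concatMap g xs) ⟩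
  sumOver (λ _ → 1) (concatMap g xs)            ≡⟨ sumOver-concatMap (λ _ → 1) g xs ⟩
  sumOver (sumOver (λ _ → 1) ∘ g) xs            ≡⟨ sumOver-cong xs (λ x → sym (length≡sumOver-1 (g x))) ⟩
  sumOver (length ∘ g) xs                       ∎
  where open ≡-Reasoning

length-vectors : (m : ℕ) (xs : List A) → length (vectors m xs) ≡ length xs ^ m
length-vectors zero    xs = refl
length-vectors (suc m) xs = begin
  length (vectors (suc m) xs)                            ≡⟨ length-concatMap _ xs ⟩
  sumOver (λ a → length (map (a ∷_) (vectors m xs))) xs  ≡⟨ sumOver-cong xs (λ a → length-map (a ∷_) (vectors m xs)) ⟩
  sumOver (λ _ → length (vectors m xs)) xs               ≡⟨ sumOver-const _ xs ⟩
  length xs * length (vectors m xs)                      ≡⟨ cong (length xs *_) (length-vectors m xs) ⟩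
  length xs ^ suc m                                      ∎
  where open ≡-Reasoning

count-vectors-suc : (P : Vec A (suc m) → Bool) (xs : List A) →
  count P (vectors (suc m) xs) ≡ sumOver (λ a → count (P ∘ (a ∷_)) (vectors m xs)) xs
count-vectors-suc {m = m} P xs =
  trans (sumOver-concatMap (ind ∘ P) (λ a → map (a ∷_) (vectors m xs)) xs)
        (sumOver-cong xs (λ a → sumOver-map (ind ∘ P) (a ∷_) (vectors m xs)))

count-const-false : (P : A → Bool) (xs : List A) → (∀ x → P x ≡ false) → count P xs ≡ 0
count-const-false P []       e = refl
count-const-false P (x ∷ xs) e rewrite e x = count-const-false P xs e

count-not+count : (P : A → Bool) (xs : List A) → count (not ∘ P) xs + count P xs ≡ length xs
count-not+count P []       = refl
count-not+count P (x ∷ xs) with P x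
... | true  = trans (+-suc (count (not ∘ P) xs) _) (cong suc (count-not+count P xs))
... | false = cong suc (count-not+count P xs)

count-mono : {P Q : A → Bool} (xs : List A) → (∀ x → P x ≡ true → Q x ≡ true) →
  count P xs ≤ count Q xs
count-mono {P = P} {Q} xs P⇒Q = sumOver-mono xs ind-mono
  where
  ind-mono : ∀ x → ind (P x) ≤ ind (Q x)
  ind-mono x with P x | P⇒Q x
  ... | false | _   = z≤n
  ... | true  | Qx rewrite Qx refl = ≤-refl

count-cong : {P Q : A → Bool} (xs : List A) → (∀ x → P x ≡ Q x) → count P xs ≡ count Q xs
count-cong xs e = sumOver-cong xs (λ x → cong ind (e x))

count<length⇒∃-false : (P : A → Bool) (xs : List A) → count P xs < length xs → ∃[ x ] P x ≡ false
count<length⇒∃-false P (x ∷ xs) lt with P x in Px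
... | false = x , Px
... | true  = count<length⇒∃-false P xs (≤-pred lt)

anyᵇ : (B → A → Bool) → List B → A → Bool
anyᵇ P []       x = false
anyᵇ P (b ∷ bs) x = P b x ∨ anyᵇ P bs x

anyᵇ≡false⇒ : (P : B → A → Bool) {b : B} (bs : List B) (x : A) → anyᵇ P bs x ≡ false → b ∈ bs → P b x ≡ false
anyᵇ≡false⇒ P (b ∷ bs) x e (here refl) = ∨-conicalˡ (P b x) _ e
anyᵇ≡false⇒ P (b ∷ bs) x e (there b∈bs) = anyᵇ≡false⇒ P bs x (∨-conicalʳ (P b x) _ e) b∈bs

ind-∨ : ∀ a b → ind (a ∨ b) ≤ ind a + ind b
ind-∨ true  b = s≤s z≤n
ind-∨ false b = ≤-refl

count-anyᵇ≤ : (P : B → A → Bool) (bs : List B) (xs : List A) →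
  count (anyᵇ P bs) xs ≤ sumOver (λ b → count (P b) xs) bs
count-anyᵇ≤ P []       xs = ≤-reflexive (count-const-false _ xs (λ _ → refl))
count-anyᵇ≤ P (b ∷ bs) xs = begin
  count (anyᵇ P (b ∷ bs)) xs                                   ≤⟨ sumOver-mono xs (λ x → ind-∨ (P b x) _) ⟩
  sumOver (λ x → ind (P b x) + ind (anyᵇ P bs x)) xs           ≡⟨ sumOver-+ _ _ xs ⟩
  count (P b) xs + count (anyᵇ P bs) xs                        ≤⟨ +-monoʳ-≤ (count (P b) xs) (count-anyᵇ≤ P bs xs) ⟩
  count (P b) xs + sumOver (λ b → count (P b) xs) bs           ∎
  where open ≤-Reasoning

count-vectors-by-coordinate : (xs : List A) (i : Fin (suc m)) (P : Vec A (suc m) → Bool) (D E : ℕ) →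
  (∀ g → D * count (λ x → P (g [ i ]≔ x)) xs ≤ E) →
  D * count P (vectors (suc m) xs) ≤ length xs ^ m * E
count-vectors-by-coordinate [] i P D E h = ≤-trans (≤-reflexive (*-zeroʳ D)) z≤n
count-vectors-by-coordinate {m = m} xs@(x₀ ∷ _) zero P D E h = begin
  D * count P (vectors (suc m) xs)                                  ≡⟨ cong (D *_) (count-vectors-suc P xs) ⟩
  D * sumOver (λ a → sumOver (λ v → ind (P (a ∷ v))) (vectors m xs)) xs
                                                                    ≡⟨ cong (D *_) (sumOver-comm _ xs (vectors m xs)) ⟩
  D * sumOver (λ v → count (λ a → P (a ∷ v)) xs) (vectors m xs)     ≡⟨ sumOver-*ˡ D _ (vectors m xs) ⟨
  sumOver (λ v → D * count (λ a → P (a ∷ v)) xs) (vectors m xs)     ≤⟨ sumOver-mono (vectors m xs) (λ v → h (x₀ ∷ v)) ⟩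
  sumOver (λ _ → E) (vectors m xs)                                  ≡⟨ sumOver-const E (vectors m xs) ⟩
  length (vectors m xs) * E                                         ≡⟨ cong (_* E) (length-vectors m xs) ⟩
  length xs ^ m * E                                                 ∎
  where open ≤-Reasoning
count-vectors-by-coordinate {m = suc m} xs (suc i) P D E h = begin
  D * count P (vectors (suc (suc m)) xs)                            ≡⟨ cong (D *_) (count-vectors-suc P xs) ⟩
  D * sumOver (λ a → count (P ∘ (a ∷_)) (vectors (suc m) xs)) xs    ≡⟨ sumOver-*ˡ D _ xs ⟨
  sumOver (λ a → D * count (P ∘ (a ∷_)) (vectors (suc m) xs)) xs    ≤⟨ sumOver-mono xs (λ a →
                                                                         count-vectors-by-coordinate xs i (P ∘ (a ∷_)) D E (λ g → h (a ∷ g))) ⟩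
  sumOver (λ _ → length xs ^ m * E) xs                              ≡⟨ sumOver-const _ xs ⟩
  length xs * (length xs ^ m * E)                                   ≡⟨ *-assoc (length xs) _ E ⟨
  length xs ^ suc m * E                                             ∎
  where open ≤-Reasoning

allᵇ : (n : ℕ) → (Fin n → Bool) → Bool
allᵇ zero    f = true
allᵇ (suc n) f = f zero ∧ allᵇ n (f ∘ suc)

allᵇ≡false⇒ : ∀ n (f : Fin n → Bool) → allᵇ n f ≡ false → ∃[ r ] f r ≡ false
allᵇ≡false⇒ (suc n) f e with f zero in f0
... | false = zero , f0
... | true  = let r , fr = allᵇ≡false⇒ n (f ∘ suc) e in suc r , fr

allᵇ-cong : ∀ n {f g : Fin n → Bool} → (∀ r → f r ≡ g r) → allᵇ n f ≡ allᵇ n g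
allᵇ-cong zero    e = refl
allᵇ-cong (suc n) e = cong₂ _∧_ (e zero) (allᵇ-cong n (e ∘ suc))

count-∧ˡ : (b : Bool) (Q : A → Bool) (xs : List A) → count (λ x → b ∧ Q x) xs ≡ ind b * count Q xs
count-∧ˡ true  Q xs = sym (+-identityʳ _)
count-∧ˡ false Q xs = count-const-false _ xs (λ _ → refl)

count-vectors-allᵇ : (xs : List A) (n : ℕ) (R : Fin n → A → Bool) (D E : ℕ) →
  (∀ r → D * count (R r) xs ≤ E) →
  D ^ n * count (λ v → allᵇ n (λ r → R r (lookup v r))) (vectors n xs) ≤ E ^ n
count-vectors-allᵇ xs zero    R D E h = ≤-refl
count-vectors-allᵇ xs (suc n) R D E h = begin
  D * D ^ n * count (λ v → allᵇ (suc n) (λ r → R r (lookup v r))) (vectors (suc n) xs)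
      ≡⟨ cong (D * D ^ n *_) (count-vectors-suc _ xs) ⟩
  D * D ^ n * sumOver (λ a → count (λ v → R zero a ∧ Q v) (vectors n xs)) xs
      ≡⟨ cong (D * D ^ n *_) (sumOver-cong xs (λ a → count-∧ˡ (R zero a) Q (vectors n xs))) ⟩
  D * D ^ n * sumOver (λ a → ind (R zero a) * c) xs
      ≡⟨ cong (D * D ^ n *_) (sumOver-*ʳ c (ind ∘ R zero) xs) ⟩
  D * D ^ n * (count (R zero) xs * c)
      ≡⟨ interchange D (D ^ n) (count (R zero) xs) c ⟩
  D * count (R zero) xs * (D ^ n * c)
      ≤⟨ *-mono-≤ (h zero) (count-vectors-allᵇ xs n (R ∘ suc) D E (h ∘ suc)) ⟩
  E * E ^ n ∎
  where
  open ≤-Reasoning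
  Q : Vec _ n → Bool
  Q v = allᵇ n (λ r → R (suc r) (lookup v r))
  c = count Q (vectors n xs)
  interchange : ∀ a b x y → a * b * (x * y) ≡ a * x * (b * y)
  interchange = solve-∀
  sumOver-*ʳ : (c : ℕ) (f : A → ℕ) (xs : List A) → sumOver (λ x → f x * c) xs ≡ sumOver f xs * c
  sumOver-*ʳ c f xs = trans (sumOver-cong xs (λ x → *-comm (f x) c)) (trans (sumOver-*ˡ c f xs) (*-comm c _))

words : ℕ → List A → List (List A)
words zero    xs = [] ∷ []
words (suc l) xs = concatMap (λ x → map (x ∷_) (words l xs)) xs

listsUpTo : ℕ → List A → List (List A)
listsUpTo zero    xs = [] ∷ []
listsUpTo (suc l) xs = [] ∷ concatMap (λ x → map (x ∷_) (listsUpTo l xs)) xs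

∈-concatMap : ∀ (f : A → List B) {x xs y} → x ∈ xs → y ∈ f x → y ∈ concatMap f xs
∈-concatMap f x∈xs y∈fx = ∈-concat⁺′ y∈fx (∈-map⁺ f x∈xs)

∈-words : {xs : List A} → (∀ x → x ∈ xs) → ∀ ws → ws ∈ words (length ws) xs
∈-words every []       = here refl
∈-words every (w ∷ ws) = ∈-concatMap _ (every w) (∈-map⁺ (w ∷_) (∈-words every ws))

∈-listsUpTo : {xs : List A} → (∀ x → x ∈ xs) → ∀ l ws → length ws ≤ l → ws ∈ listsUpTo l xs
∈-listsUpTo every zero    []       _          = here refl
∈-listsUpTo every (suc l) []       _          = here refl
∈-listsUpTo every (suc l) (w ∷ ws) (s≤s len≤l) =
  there (∈-concatMap _ (every w) (∈-map⁺ (w ∷_) (∈-listsUpTo every l ws len≤l)))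

length-words : ∀ l (xs : List A) → length (words l xs) ≡ length xs ^ l
length-words zero    xs = refl
length-words (suc l) xs = begin
  length (words (suc l) xs)                               ≡⟨ length-concatMap _ xs ⟩
  sumOver (λ x → length (map (x ∷_) (words l xs))) xs     ≡⟨ sumOver-cong xs (λ x → length-map (x ∷_) (words l xs)) ⟩
  sumOver (λ _ → length (words l xs)) xs                  ≡⟨ sumOver-const _ xs ⟩
  length xs * length (words l xs)                         ≡⟨ cong (length xs *_) (length-words l xs) ⟩
  length xs ^ suc l                                       ∎
  where open ≡-Reasoning

sumOver-^length-listsUpTo≤ : ∀ c l (xs : List A) → 1 ≤ c * length xs →
  sumOver (λ ws → c ^ length ws) (listsUpTo l xs) ≤ suc l * (c * length xs) ^ l
sumOver-^length-listsUpTo≤ c zero    xs _        = ≤-refl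
sumOver-^length-listsUpTo≤ c (suc l) xs 1≤M = begin
  1 + sumOver (λ ws → c ^ length ws) (concatMap (λ x → map (x ∷_) (listsUpTo l xs)) xs)
    ≡⟨ cong suc (trans (sumOver-concatMap _ _ xs) (sumOver-cong xs (λ x →
         trans (sumOver-map _ (x ∷_) (listsUpTo l xs)) (sumOver-*ˡ c _ (listsUpTo l xs))))) ⟩
  1 + sumOver (λ _ → c * W) xs              ≡⟨ cong suc (trans (sumOver-const _ xs) (*-comm-assoc (length xs) c W)) ⟩
  1 + M * W                                 ≤⟨ +-mono-≤ (≤-trans 1≤M (m≤m*n M (M ^ l) {{m^n≢0 M l {{M-nonZero}}}})) (*-monoʳ-≤ M (sumOver-^length-listsUpTo≤ c l xs 1≤M)) ⟩
  M ^ suc l + M * (suc l * M ^ l)           ≡⟨ cong (M ^ suc l +_) (*-comm-assoc′ M (suc l) (M ^ l)) ⟩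
  suc (suc l) * M ^ suc l                   ∎
  where
  open ≤-Reasoning
  M = c * length xs
  W = sumOver (λ ws → c ^ length ws) (listsUpTo l xs)
  M-nonZero : NonZero M
  M-nonZero = >-nonZero 1≤M
  *-comm-assoc : ∀ a b c → a * (b * c) ≡ b * a * c
  *-comm-assoc = solve-∀
  *-comm-assoc′ : ∀ a b c → a * (b * c) ≡ b * (a * c)
  *-comm-assoc′ = solve-∀

bools : List Bool
bools = true ∷ false ∷ []

agree : Bool → Bool → Bool
agree x y = not (x xor y)

PartialAssignment : ℕ → Set
PartialAssignment = Vec (Maybe Bool)

extends : ∀ {n} → Vec Bool n → PartialAssignment n → Bool
extends []      []            = true
extends (b ∷ r) (nothing ∷ c) = extends r c
extends (b ∷ r) (just q ∷ c)  = agree b q ∧ extends r c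

#assigned : ∀ {n} → PartialAssignment n → ℕ
#assigned []            = 0
#assigned (nothing ∷ c) = #assigned c
#assigned (just _ ∷ c)  = suc (#assigned c)

2^n≤2^#assigned*count-extends : ∀ {n} (c : PartialAssignment n) →
  2 ^ n ≤ 2 ^ #assigned c * count (λ r → extends r c) (vectors n bools)
2^n≤2^#assigned*count-extends []  = ≤-refl
2^n≤2^#assigned*count-extends {suc n} (nothing ∷ c) = begin
  2 * 2 ^ n                           ≤⟨ *-monoʳ-≤ 2 (2^n≤2^#assigned*count-extends c) ⟩
  2 * (2 ^ #assigned c * C)           ≡⟨ double-count (2 ^ #assigned c) C ⟩
  2 ^ #assigned c * (C + (C + 0))     ≡⟨ cong (2 ^ #assigned c *_) (count-vectors-suc (λ r → extends r (nothing ∷ c)) bools) ⟨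
  2 ^ #assigned c * count (λ r → extends r (nothing ∷ c)) (vectors (suc n) bools) ∎
  where
  open ≤-Reasoning
  C = count (λ r → extends r c) (vectors n bools)
  double-count : ∀ a b → 2 * (a * b) ≡ a * (b + (b + 0))
  double-count = solve-∀
2^n≤2^#assigned*count-extends {suc n} (just q ∷ c) = begin
  2 * 2 ^ n                           ≤⟨ *-monoʳ-≤ 2 (2^n≤2^#assigned*count-extends c) ⟩
  2 * (2 ^ #assigned c * C)           ≡⟨ *-assoc 2 (2 ^ #assigned c) C ⟨
  2 * 2 ^ #assigned c * C             ≤⟨ *-monoʳ-≤ (2 * 2 ^ #assigned c) (C≤ q) ⟩
  2 * 2 ^ #assigned c * count (λ r → extends r (just q ∷ c)) (vectors (suc n) bools) ∎
  where
  open ≤-Reasoning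
  C = count (λ r → extends r c) (vectors n bools)
  C≤ : ∀ q → C ≤ count (λ r → extends r (just q ∷ c)) (vectors (suc n) bools)
  C≤ true  rewrite count-vectors-suc (λ r → extends r (just true ∷ c)) bools = m≤m+n C _
  C≤ false rewrite count-vectors-suc (λ r → extends r (just false ∷ c)) bools =
    ≤-trans (≤-reflexive (sym (+-identityʳ C))) (m≤n+m (C + 0) (count (λ r → extends (true ∷ r) (just false ∷ c)) (vectors n bools)))

assignment : ∀ {n} → List (Fin n) → List Bool → PartialAssignment n
assignment (p ∷ ps) (q ∷ qs) = assignment ps qs [ p ]≔ just q
assignment _        _        = replicate _ nothing

agreesAt : ∀ {n} → Vec Bool n → List (Fin n) → List Bool → Bool
agreesAt r []       _        = true
agreesAt r (p ∷ ps) []       = false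
agreesAt r (p ∷ ps) (q ∷ qs) = agree (lookup r p) q ∧ agreesAt r ps qs

#assigned-replicate : ∀ n → #assigned (replicate n nothing) ≡ 0
#assigned-replicate zero    = refl
#assigned-replicate (suc n) = #assigned-replicate n

#assigned-assign : ∀ {n} (c : PartialAssignment n) p q → #assigned (c [ p ]≔ just q) ≤ suc (#assigned c)
#assigned-assign (nothing ∷ c) zero    q = ≤-refl
#assigned-assign (just _ ∷ c)  zero    q = n≤1+n _
#assigned-assign (nothing ∷ c) (suc p) q = #assigned-assign c p q
#assigned-assign (just _ ∷ c)  (suc p) q = s≤s (#assigned-assign c p q)

#assigned-assignment : ∀ {n} (ps : List (Fin n)) qs → #assigned (assignment ps qs) ≤ length ps
#assigned-assignment (p ∷ ps) (q ∷ qs) = ≤-trans (#assigned-assign (assignment ps qs) p q) (s≤s (#assigned-assignment ps qs))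
#assigned-assignment {n} []       qs = ≤-reflexive (#assigned-replicate n)
#assigned-assignment {n} (p ∷ ps) [] = ≤-trans (≤-reflexive (#assigned-replicate n)) z≤n

extends-assign : ∀ {n} (r : Vec Bool n) (c : PartialAssignment n) p q → lookup c p ≡ nothing →
  extends r (c [ p ]≔ just q) ≡ true → agree (lookup r p) q ≡ true × extends r c ≡ true
extends-assign (b ∷ r) (nothing ∷ c) zero    q free h = ∧-conicalˡ _ _ h , ∧-conicalʳ _ _ h
extends-assign (b ∷ r) (nothing ∷ c) (suc p) q free h = extends-assign r c p q free h
extends-assign (b ∷ r) (just x ∷ c)  (suc p) q free h with agree b x | h
... | true | h′ = extends-assign r c p q free h′

lookup-assignment : ∀ {n} (p : Fin n) ps qs → All (p ≢_) ps → lookup (assignment ps qs) p ≡ nothing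
lookup-assignment p (p′ ∷ ps) (q ∷ qs) (p≢p′ ∷ p∉ps) =
  trans (lookup∘update′ p≢p′ (assignment ps qs) (just q)) (lookup-assignment p ps qs p∉ps)
lookup-assignment p []       qs _ = lookup-replicate p nothing
lookup-assignment p (_ ∷ _)  [] _ = lookup-replicate p nothing

extends-assignment⇒agreesAt : ∀ {n} (r : Vec Bool n) ps qs → Unique ps → length ps ≡ length qs →
  extends r (assignment ps qs) ≡ true → agreesAt r ps qs ≡ true
extends-assignment⇒agreesAt r []       qs       _              _   _ = refl
extends-assignment⇒agreesAt r (p ∷ ps) (q ∷ qs) (p∉ps ∷ ps-distinct) len h
  with extends-assign r (assignment ps qs) p q (lookup-assignment p ps qs p∉ps) h
... | agree-p , ext rewrite agree-p =
  extends-assignment⇒agreesAt r ps qs ps-distinct (suc-injective len) ext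

2^t*count-disagreesAt≤ : ∀ {n} t (ps : List (Fin n)) qs → Unique ps → length ps ≡ length qs → length ps ≤ t →
  2 ^ t * count (λ r → not (agreesAt r ps qs)) (vectors n bools) ≤ (2 ^ t ∸ 1) * 2 ^ n
2^t*count-disagreesAt≤ {n} t ps qs distinct len len≤t = begin
  2 ^ t * #disagree            ≤⟨ m+n≤o⇒m≤o∸n (2 ^ t * #disagree) key ⟩
  2 ^ t * 2 ^ n ∸ 2 ^ n         ≡⟨ cong (2 ^ t * 2 ^ n ∸_) (*-identityˡ (2 ^ n)) ⟨
  2 ^ t * 2 ^ n ∸ 1 * 2 ^ n     ≡⟨ *-distribʳ-∸ (2 ^ n) (2 ^ t) 1 ⟨
  (2 ^ t ∸ 1) * 2 ^ n           ∎
  where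
  open ≤-Reasoning
  #disagree = count (λ r → not (agreesAt r ps qs)) (vectors n bools)
  #agree    = count (λ r → agreesAt r ps qs) (vectors n bools)
  total : #disagree + #agree ≡ 2 ^ n
  total = trans (count-not+count (λ r → agreesAt r ps qs) (vectors n bools)) (length-vectors n bools)
  2^n≤2^t*#agree : 2 ^ n ≤ 2 ^ t * #agree
  2^n≤2^t*#agree = ≤-trans (2^n≤2^#assigned*count-extends (assignment ps qs))
    (*-mono-≤ (^-monoʳ-≤ 2 (≤-trans (#assigned-assignment ps qs) len≤t))
              (count-mono (vectors n bools) (λ r → extends-assignment⇒agreesAt r ps qs distinct len)))
  key : 2 ^ t * #disagree + 2 ^ n ≤ 2 ^ t * 2 ^ n
  key = begin
    2 ^ t * #disagree + 2 ^ n          ≤⟨ +-monoʳ-≤ (2 ^ t * #disagree) 2^n≤2^t*#agree ⟩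
    2 ^ t * #disagree + 2 ^ t * #agree ≡⟨ *-distribˡ-+ (2 ^ t) #disagree #agree ⟨
    2 ^ t * (#disagree + #agree)       ≡⟨ cong (2 ^ t *_) total ⟩
    2 ^ t * 2 ^ n                      ∎

<ᵇ-antisym : ∀ a b → a ≢ b → (a <ᵇ b) ≡ not (b <ᵇ a)
<ᵇ-antisym zero    zero    a≢b = ⊥-elim (a≢b refl)
<ᵇ-antisym zero    (suc b) a≢b = refl
<ᵇ-antisym (suc a) zero    a≢b = refl
<ᵇ-antisym (suc a) (suc b) a≢b = <ᵇ-antisym a b (a≢b ∘ cong suc)

-- The random orientation is encoded by one bit bit(v , u) for every ordered pair of vertices:
-- the arc between v ∈ P_i and u ∈ P_j is bit(v , u) xor bit(u , v), flipped when j < i.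
-- Hence, once the bits of all parts other than P_i are fixed, the arcs leaving P_i are the
-- bits bit(v , -), v ∈ P_i, of P_i's own block xor a fixed mask, i.e. independent and uniform.
module Construction (m N t : ℕ) where

  k n : ℕ
  k = suc m
  n = k * N

  V : Set
  V = Vertex k N

  Block Bits : Set
  Block = Vec (Vec Bool n) N
  Bits  = Vec Block k

  blocks : List Block
  blocks = vectors N (vectors n bools)

  allBits : List Bits
  allBits = vectors k blocks

  index : V → Fin n
  index (i , a) = combine i a

  index-injective : ∀ {u v} → index u ≡ index v → u ≡ v
  index-injective {i , a} {j , b} e = let i≡j , a≡b = combine-injective i a j b e in cong₂ _,_ i≡j a≡b

  bit : Bits → V → V → Bool
  bit T (i , a) u = lookup (lookup (lookup T i) a) (index u)

  below : Fin k → Fin k → Bool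
  below j i = toℕ j <ᵇ toℕ i

  arcᵇ : Bits → V → V → Bool
  arcᵇ T (i , a) (j , b) with i ≟ᶠ j
  ... | yes _ = false
  ... | no  _ = below j i xor (bit T (i , a) (j , b) xor bit T (j , b) (i , a))

  orientation : Bits → Orientation k N
  orientation T = record { arc = arcᵇ T ; between = between′ ; inside = inside′ }
    where
    between′ : ∀ u v → part u ≢ part v → arcᵇ T u v ≡ not (arcᵇ T v u)
    between′ (i , a) (j , b) i≢j with i ≟ᶠ j | j ≟ᶠ i
    ... | yes i≡j | _       = ⊥-elim (i≢j i≡j)
    ... | no _    | yes j≡i = ⊥-elim (i≢j (sym j≡i))
    ... | no _    | no _    = begin
      below j i xor (x xor y)        ≡⟨ cong (_xor (x xor y)) (<ᵇ-antisym (toℕ j) (toℕ i) (i≢j ∘ sym ∘ toℕ-injective)) ⟩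
      not (below i j) xor (x xor y)  ≡⟨ not-distribˡ-xor (below i j) (x xor y) ⟨
      not (below i j xor (x xor y))  ≡⟨ cong (λ z → not (below i j xor z)) (xor-comm x y) ⟩
      not (below i j xor (y xor x))  ∎
      where
      open ≡-Reasoning
      x = bit T (i , a) (j , b)
      y = bit T (j , b) (i , a)
    inside′ : ∀ u v → part u ≡ part v → arcᵇ T u v ≡ false
    inside′ (i , a) (j , b) i≡j with i ≟ᶠ j
    ... | yes _   = refl
    ... | no i≢j  = ⊥-elim (i≢j i≡j)

  mask : Bits → Fin k → Fin N → V → Bool
  mask T i r (j , b) = below j i xor bit T (j , b) (i , r)

  arcᵇ-update : ∀ T i r (X : Block) u → part u ≢ i →
    arcᵇ (T [ i ]≔ X) (i , r) u ≡ lookup (lookup X r) (index u) xor mask T i r u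
  arcᵇ-update T i r X (j , b) j≢i with i ≟ᶠ j
  ... | yes i≡j = ⊥-elim (j≢i (sym i≡j))
  ... | no  i≢j = begin
    below j i xor (bit T′ (i , r) (j , b) xor bit T′ (j , b) (i , r))
      ≡⟨ cong₂ (λ Tᵢ Tⱼ → below j i xor (lookup (lookup Tᵢ r) (index (j , b)) xor lookup (lookup Tⱼ b) (index (i , r))))
               (lookup∘update i T X) (lookup∘update′ (i≢j ∘ sym) T X) ⟩
    below j i xor (x xor y)   ≡⟨ xor-assoc (below j i) x y ⟨
    (below j i xor x) xor y   ≡⟨ cong (_xor y) (xor-comm (below j i) x) ⟩
    (x xor below j i) xor y   ≡⟨ xor-assoc x (below j i) y ⟩
    x xor (below j i xor y)   ∎
    where
    open ≡-Reasoning
    T′ = T [ i ]≔ X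
    x  = lookup (lookup X r) (index (j , b))
    y  = bit T (j , b) (i , r)

  plus? : Sign → Bool
  plus? minus = false
  plus? plus  = true

  realises : List Bool → List Sign → Bool
  realises []       []       = true
  realises (b ∷ bs) (s ∷ ss) = agree b (plus? s) ∧ realises bs ss
  realises _        _        = false

  realises⇒F≡ : ∀ (K : Orientation k N) v A a → realises (map (arc K v) A) a ≡ true → F A v K ≡ a
  realises⇒F≡ K v []       []       _ = refl
  realises⇒F≡ K v (u ∷ A) (s ∷ a) h = cong₂ _∷_ (sign≡ s (∧-conicalˡ _ _ h)) (realises⇒F≡ K v A a (∧-conicalʳ _ _ h))
    where
    sign≡ : ∀ s → agree (arc K v u) (plus? s) ≡ true → sign K v u ≡ s
    sign≡ s agrees with arc K v u
    sign≡ minus _ | false = refl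
    sign≡ plus  _ | true  = refl

  targets : Bits → Fin k → Fin N → List V → List Sign → List Bool
  targets T i r (u ∷ A) (s ∷ a) = (mask T i r u xor plus? s) ∷ targets T i r A a
  targets T i r _       _       = []

  length-targets : ∀ T i r A a → length a ≡ length A → length (map index A) ≡ length (targets T i r A a)
  length-targets T i r []      []      _   = refl
  length-targets T i r (u ∷ A) (s ∷ a) len = cong suc (length-targets T i r A a (suc-injective len))

  realises-update : ∀ T i r (X : Block) A a → All (λ u → part u ≢ i) A → length a ≡ length A →
    realises (map (arcᵇ (T [ i ]≔ X) (i , r)) A) a ≡ agreesAt (lookup X r) (map index A) (targets T i r A a)
  realises-update T i r X []      []      _            _   = refl
  realises-update T i r X (u ∷ A) (s ∷ a) (u∉Pᵢ ∷ A∉Pᵢ) len rewrite arcᵇ-update T i r X u u∉Pᵢ =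
    cong₂ _∧_ (agree-xor (lookup (lookup X r) (index u)) (mask T i r u) (plus? s))
              (realises-update T i r X A a A∉Pᵢ (suc-injective len))
    where
    agree-xor : ∀ x y z → agree (x xor y) z ≡ agree x (y xor z)
    agree-xor x y z = cong not (xor-assoc x y z)

  Request : Set
  Request = Fin k × List V × List Sign

  Admissible : Request → Set
  Admissible (i , A , a) = Unique A × All (λ u → part u ≢ i) A × length a ≡ length A × length A ≤ t

  admissible? : ∀ ρ → Dec (Admissible ρ)
  admissible? (i , A , a) =
    allPairs? (λ u v → ¬? (≡-dec _≟ᶠ_ _≟ᶠ_ u v)) A ×-dec all? (λ u → ¬? (part u ≟ᶠ i)) A ×-dec length a ≟ length A ×-dec length A ≤? t

  noneRealise : Fin k → List V → List Sign → Bits → Bool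
  noneRealise i A a T = allᵇ N (λ r → not (realises (map (arcᵇ T (i , r)) A) a))

  -- requests below also lists inadmissible triples (repeated vertices, vertices in P_i); they never count as unmet.
  unmet : Request → Bits → Bool
  unmet ρ@(i , A , a) T = does (admissible? ρ) ∧ noneRealise i A a T

  2^tN*count-unmet-update≤ : ∀ T i A a →
    (2 ^ t) ^ N * count (λ X → unmet (i , A , a) (T [ i ]≔ X)) blocks ≤ ((2 ^ t ∸ 1) * 2 ^ n) ^ N
  2^tN*count-unmet-update≤ T i A a = gated (admissible? (i , A , a))
    where
    open ≤-Reasoning
    gated : (d : Dec (Admissible (i , A , a))) →
      (2 ^ t) ^ N * count (λ X → does d ∧ noneRealise i A a (T [ i ]≔ X)) blocks ≤ ((2 ^ t ∸ 1) * 2 ^ n) ^ N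
    gated (no _) = ≤-trans (≤-reflexive (trans (cong ((2 ^ t) ^ N *_) (count-const-false _ blocks (λ _ → refl)))
                                              (*-zeroʳ ((2 ^ t) ^ N)))) z≤n
    gated (yes (distinct , A∉Pᵢ , len , len≤t)) = begin
      (2 ^ t) ^ N * count (λ X → noneRealise i A a (T [ i ]≔ X)) blocks
        ≡⟨ cong ((2 ^ t) ^ N *_) (count-cong blocks (λ X → allᵇ-cong N (λ r →
             cong not (realises-update T i r X A a A∉Pᵢ len)))) ⟩
      (2 ^ t) ^ N * count (λ X → allᵇ N (λ r → misses r (lookup X r))) blocks
        ≤⟨ count-vectors-allᵇ (vectors n bools) N misses (2 ^ t) ((2 ^ t ∸ 1) * 2 ^ n) (λ r →
             2^t*count-disagreesAt≤ t (map index A) (targets T i r A a) (map⁺ index-injective distinct)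
               (length-targets T i r A a len) (≤-trans (≤-reflexive (length-map index A)) len≤t)) ⟩
      ((2 ^ t ∸ 1) * 2 ^ n) ^ N ∎
      where
      misses : Fin N → Vec Bool n → Bool
      misses r row = not (agreesAt row (map index A) (targets T i r A a))

  length-blocks : length blocks ≡ (2 ^ n) ^ N
  length-blocks = trans (length-vectors N (vectors n bools)) (cong (_^ N) (length-vectors n bools))

  2^tN*count-unmet≤ : ∀ ρ → (2 ^ t) ^ N * count (unmet ρ) allBits ≤ (2 ^ t ∸ 1) ^ N * length allBits
  2^tN*count-unmet≤ ρ@(i , A , a) = begin
    (2 ^ t) ^ N * count (unmet ρ) allBits
      ≤⟨ count-vectors-by-coordinate blocks i (unmet ρ) ((2 ^ t) ^ N) _ (λ T → 2^tN*count-unmet-update≤ T i A a) ⟩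
    L ^ m * ((2 ^ t ∸ 1) * 2 ^ n) ^ N       ≡⟨ cong (L ^ m *_) (^-distribʳ-* (2 ^ t ∸ 1) (2 ^ n) N) ⟩
    L ^ m * ((2 ^ t ∸ 1) ^ N * (2 ^ n) ^ N) ≡⟨ cong (λ z → L ^ m * ((2 ^ t ∸ 1) ^ N * z)) length-blocks ⟨
    L ^ m * ((2 ^ t ∸ 1) ^ N * L)           ≡⟨ rearrange (L ^ m) ((2 ^ t ∸ 1) ^ N) L ⟩
    (2 ^ t ∸ 1) ^ N * (L * L ^ m)           ≡⟨ cong ((2 ^ t ∸ 1) ^ N *_) (length-vectors k blocks) ⟨
    (2 ^ t ∸ 1) ^ N * length allBits        ∎
    where
    open ≤-Reasoning
    L = length blocks
    rearrange : ∀ a b c → a * (b * c) ≡ b * (c * a)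
    rearrange = solve-∀

  anyUnmet : List Request → Bits → Bool
  anyUnmet = anyᵇ unmet

  ∃-all-met : ∀ ρs → length ρs * (2 ^ t ∸ 1) ^ N < (2 ^ t) ^ N → ∃[ T ] anyUnmet ρs T ≡ false
  ∃-all-met ρs small = count<length⇒∃-false (anyUnmet ρs) allBits
    (*-cancelˡ-< ((2 ^ t) ^ N) _ _ (begin-strict
      (2 ^ t) ^ N * count (anyUnmet ρs) allBits
        ≤⟨ *-monoʳ-≤ ((2 ^ t) ^ N) (count-anyᵇ≤ unmet ρs allBits) ⟩
      (2 ^ t) ^ N * sumOver (λ ρ → count (unmet ρ) allBits) ρs
        ≡⟨ sumOver-*ˡ ((2 ^ t) ^ N) (λ ρ → count (unmet ρ) allBits) ρs ⟨
      sumOver (λ ρ → (2 ^ t) ^ N * count (unmet ρ) allBits) ρs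
        ≤⟨ sumOver-mono ρs 2^tN*count-unmet≤ ⟩
      sumOver (λ _ → (2 ^ t ∸ 1) ^ N * length allBits) ρs
        ≡⟨ trans (sumOver-const _ ρs) (sym (*-assoc (length ρs) _ _)) ⟩
      length ρs * (2 ^ t ∸ 1) ^ N * length allBits
        <⟨ *-monoˡ-< (length allBits) small ⟩
      (2 ^ t) ^ N * length allBits ∎))
    where
    open ≤-Reasoning
    instance
      allBits-nonZero : NonZero (length allBits)
      allBits-nonZero = subst NonZero (sym (trans (length-vectors k blocks) (cong (_^ k) length-blocks)))
        (m^n≢0 ((2 ^ n) ^ N) k {{m^n≢0 (2 ^ n) N {{m^n≢0 2 n}}}})

  vertices : List V
  vertices = map (remQuot {k} N) (allFin n)

  ∈-vertices : ∀ u → u ∈ vertices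
  ∈-vertices u@(i , a) = subst (_∈ vertices) (remQuot-combine i a) (∈-map⁺ (remQuot {k} N) (∈-allFin (index u)))

  signs : List Sign
  signs = minus ∷ plus ∷ []

  ∈-signs : ∀ s → s ∈ signs
  ∈-signs minus = here refl
  ∈-signs plus  = there (here refl)

  requestsFor : Fin k → List V → List Request
  requestsFor i A = map (λ a → i , A , a) (words (length A) signs)

  requestsUpTo : Fin k → List Request
  requestsUpTo i = concatMap (requestsFor i) (listsUpTo t vertices)

  requests : List Request
  requests = concatMap requestsUpTo (allFin k)

  ∈-requests : ∀ i A a → length A ≤ t → length a ≡ length A → (i , A , a) ∈ requests
  ∈-requests i A a len≤t len = ∈-concatMap requestsUpTo (∈-allFin i) (∈-concatMap (requestsFor i) (∈-listsUpTo ∈-vertices t A len≤t)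
    (subst (λ l → (i , A , a) ∈ map (λ a → i , A , a) (words l signs)) len (∈-map⁺ _ (∈-words ∈-signs a))))

  length-requests≤ : 1 ≤ N → length requests ≤ k * (suc t * (2 * (k * N)) ^ t)
  length-requests≤ 1≤N = begin
    length requests
      ≡⟨ length-concatMap requestsUpTo (allFin k) ⟩
    sumOver (λ i → length (requestsUpTo i)) (allFin k)
      ≡⟨ sumOver-cong (allFin k) (λ i → trans (length-concatMap (requestsFor i) (listsUpTo t vertices))
           (sumOver-cong (listsUpTo t vertices) (λ A → trans (length-map _ (words (length A) signs)) (length-words (length A) signs)))) ⟩
    sumOver (λ _ → sumOver (λ A → 2 ^ length A) (listsUpTo t vertices)) (allFin k)
      ≡⟨ trans (sumOver-const _ (allFin k)) (cong (_* sumOver (λ A → 2 ^ length A) (listsUpTo t vertices)) (length-allFin k)) ⟩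
    k * sumOver (λ A → 2 ^ length A) (listsUpTo t vertices)
      ≤⟨ *-monoʳ-≤ k (sumOver-^length-listsUpTo≤ 2 t vertices (subst (λ l → 1 ≤ 2 * l) (sym length-vertices) 1≤2n)) ⟩
    k * (suc t * (2 * length vertices) ^ t)
      ≡⟨ cong (λ l → k * (suc t * (2 * l) ^ t)) length-vertices ⟩
    k * (suc t * (2 * (k * N)) ^ t) ∎
    where
    open ≤-Reasoning
    length-allFin : ∀ l → length (allFin l) ≡ l
    length-allFin l = length-tabulate id
    length-vertices : length vertices ≡ n
    length-vertices = trans (length-map (remQuot {k} N) (allFin n)) (length-allFin n)
    1≤2n : 1 ≤ 2 * n
    1≤2n = *-mono-≤ {1} {2} (s≤s z≤n) (*-mono-≤ {1} {k} (s≤s z≤n) 1≤N)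

  all-met⇒full : (T : Bits) → anyUnmet requests T ≡ false → Full k t N (orientation T)
  all-met⇒full T all-met i A distinct A∉Pᵢ len≤t a len = (i , r) , refl ,
    realises⇒F≡ (orientation T) (i , r) A a (not-injective r-realises)
    where
    unmet≡false : unmet (i , A , a) T ≡ false
    unmet≡false = anyᵇ≡false⇒ unmet requests T all-met (∈-requests i A a len≤t len)
    none : noneRealise i A a T ≡ false
    none = trans (cong (_∧ noneRealise i A a T) (sym (dec-true (admissible? (i , A , a)) (distinct , A∉Pᵢ , len , len≤t)))) unmet≡false
    r = proj₁ (allᵇ≡false⇒ N _ none)
    r-realises = proj₂ (allᵇ≡false⇒ N _ none)

^-cancelˡ-< : ∀ e {a b} → a ^ e < b ^ e → a < b
^-cancelˡ-< e lt = ≰⇒> (λ b≤a → <⇒≱ lt (^-monoˡ-≤ e b≤a))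

bernoulli : ∀ c n → c ^ n * (c + n) ≤ suc c ^ n * c
bernoulli c zero    = ≤-reflexive (trans (*-identityˡ (c + 0)) (trans (+-identityʳ c) (sym (*-identityˡ c))))
bernoulli c (suc n) = begin
  c * c ^ n * (c + suc n)    ≡⟨ swap c (c ^ n) (c + suc n) ⟩
  c * (c + suc n) * c ^ n    ≤⟨ *-monoˡ-≤ (c ^ n) step ⟩
  suc c * (c + n) * c ^ n    ≡⟨ swap′ (suc c) (c + n) (c ^ n) ⟩
  suc c * (c ^ n * (c + n))  ≤⟨ *-monoʳ-≤ (suc c) (bernoulli c n) ⟩
  suc c * (suc c ^ n * c)    ≡⟨ *-assoc (suc c) (suc c ^ n) c ⟨
  suc c * suc c ^ n * c      ∎
  where
  open ≤-Reasoning
  swap : ∀ a b c → a * b * c ≡ a * c * b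
  swap = solve-∀
  swap′ : ∀ a b c → a * b * c ≡ a * (c * b)
  swap′ = solve-∀
  step : c * (c + suc n) ≤ suc c * (c + n)
  step = ≤-trans (≤-reflexive (trans (cong (c *_) (+-suc c n)) (*-suc c (c + n)))) (+-monoˡ-≤ (c * (c + n)) (m≤m+n c n))

2*c^[1+c]≤[1+c]^[1+c] : ∀ c → 2 * c ^ suc c ≤ suc c ^ suc c
2*c^[1+c]≤[1+c]^[1+c] zero      = z≤n
2*c^[1+c]≤[1+c]^[1+c] c@(suc _) = *-cancelʳ-≤ (2 * c ^ suc c) (suc c ^ suc c) c (begin
  2 * c ^ suc c * c         ≡⟨ rearrange c (c ^ suc c) ⟩
  c ^ suc c * (c + c)       ≤⟨ *-monoʳ-≤ (c ^ suc c) (+-monoʳ-≤ c (n≤1+n c)) ⟩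
  c ^ suc c * (c + suc c)   ≤⟨ bernoulli c (suc c) ⟩
  suc c ^ suc c * c         ∎)
  where
  open ≤-Reasoning
  rearrange : ∀ c x → 2 * x * c ≡ x * (c + c)
  rearrange = solve-∀

-- (1 - 1/(c+1))^(c+1) ≤ 1/2, raised to the power P.
2^P*c^Q≤[1+c]^Q : ∀ c P Q → suc c * P ≤ Q → 2 ^ P * c ^ Q ≤ suc c ^ Q
2^P*c^Q≤[1+c]^Q c P Q [1+c]P≤Q = begin
  2 ^ P * c ^ Q                           ≡⟨ cong (λ z → 2 ^ P * c ^ z) Q≡ ⟩
  2 ^ P * c ^ (suc c * P + e)             ≡⟨ cong (2 ^ P *_) (^-distribˡ-+-* c (suc c * P) e) ⟩
  2 ^ P * (c ^ (suc c * P) * c ^ e)       ≡⟨ *-assoc (2 ^ P) _ _ ⟨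
  2 ^ P * c ^ (suc c * P) * c ^ e         ≡⟨ cong (λ z → 2 ^ P * z * c ^ e) (^-*-assoc c (suc c) P) ⟨
  2 ^ P * (c ^ suc c) ^ P * c ^ e         ≡⟨ cong (_* c ^ e) (^-distribʳ-* 2 (c ^ suc c) P) ⟨
  (2 * c ^ suc c) ^ P * c ^ e             ≤⟨ *-mono-≤ (^-monoˡ-≤ P (2*c^[1+c]≤[1+c]^[1+c] c)) (^-monoˡ-≤ e (n≤1+n c)) ⟩
  (suc c ^ suc c) ^ P * suc c ^ e         ≡⟨ cong (_* suc c ^ e) (^-*-assoc (suc c) (suc c) P) ⟩
  suc c ^ (suc c * P) * suc c ^ e         ≡⟨ ^-distribˡ-+-* (suc c) (suc c * P) e ⟨
  suc c ^ (suc c * P + e)                 ≡⟨ cong (suc c ^_) Q≡ ⟨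
  suc c ^ Q                               ∎
  where
  open ≤-Reasoning
  e = Q ∸ suc c * P
  Q≡ : Q ≡ suc c * P + e
  Q≡ = sym (m+[n∸m]≡n [1+c]P≤Q)

≤⌈/10⌉*10 : ∀ x → x ≤ ⌈ x /10⌉ * 10
≤⌈/10⌉*10 x = +-cancelʳ-≤ 9 _ _ (begin
  x + 9                                ≡⟨ m≡m%n+[m/n]*n (x + 9) 10 ⟩
  (x + 9) % 10 + ⌈ x /10⌉ * 10         ≤⟨ +-monoˡ-≤ (⌈ x /10⌉ * 10) (≤-pred (m%n<n (x + 9) 10)) ⟩
  9 + ⌈ x /10⌉ * 10                    ≡⟨ +-comm 9 _ ⟩
  ⌈ x /10⌉ * 10 + 9                    ∎)
  where open ≤-Reasoning

partSize : ℕ → ℕ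
partSize t = ⌈ 33 * (t * t) * 2 ^ t /10⌉

partSize≤ : ∀ t → 1 ≤ t → partSize t ≤ 4 * (t * t) * 2 ^ t
partSize≤ t 1≤t = *-cancelʳ-≤ (partSize t) (4 * (t * t) * 2 ^ t) 10 (begin
  partSize t * 10                  ≤⟨ m/n*n≤m (x + 9) 10 ⟩
  x + 9                            ≤⟨ +-monoʳ-≤ x 9≤ ⟩
  x + 7 * (t * t) * 2 ^ t          ≡⟨ sum (t * t) (2 ^ t) ⟩
  4 * (t * t) * 2 ^ t * 10         ∎)
  where
  open ≤-Reasoning
  x = 33 * (t * t) * 2 ^ t
  sum : ∀ a b → 33 * a * b + 7 * a * b ≡ 4 * a * b * 10
  sum = solve-∀
  9≤ : 9 ≤ 7 * (t * t) * 2 ^ t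
  9≤ = ≤-trans (≤ᵇ⇒≤ 9 14 _) (*-mono-≤ {7 * 1} {7 * (t * t)} {2} (*-monoʳ-≤ 7 (*-mono-≤ 1≤t 1≤t)) (^-monoʳ-≤ 2 1≤t))

[32t²]^10<2^[13t] : ∀ t → 9 ≤ t → (32 * (t * t)) ^ 10 < 2 ^ (13 * t)
[32t²]^10<2^[13t] t 9≤t = go t (≤⇒≤′ 9≤t)
  where
  go : ∀ t → 9 ≤′ t → (32 * (t * t)) ^ 10 < 2 ^ (13 * t)
  go .9      ≤′-refl        = ≤ᵇ⇒≤ _ _ _
  go (suc t) (≤′-step 9≤′t) = *-cancelˡ-< (4 ^ 10) _ _ (begin-strict
    4 ^ 10 * (32 * (suc t * suc t)) ^ 10    ≡⟨ ^-distribʳ-* 4 (32 * (suc t * suc t)) 10 ⟨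
    (4 * (32 * (suc t * suc t))) ^ 10       ≤⟨ ^-monoˡ-≤ 10 quadratic-step ⟩
    (9 * (32 * (t * t))) ^ 10               ≡⟨ ^-distribʳ-* 9 (32 * (t * t)) 10 ⟩
    9 ^ 10 * (32 * (t * t)) ^ 10            <⟨ *-monoʳ-< (9 ^ 10) (go t 9≤′t) ⟩
    9 ^ 10 * 2 ^ (13 * t)                   ≤⟨ *-monoˡ-≤ (2 ^ (13 * t)) (≤ᵇ⇒≤ (9 ^ 10) (4 ^ 10 * 2 ^ 13) _) ⟩
    4 ^ 10 * 2 ^ 13 * 2 ^ (13 * t)          ≡⟨ *-assoc (4 ^ 10) (2 ^ 13) (2 ^ (13 * t)) ⟩
    4 ^ 10 * (2 ^ 13 * 2 ^ (13 * t))        ≡⟨ cong (4 ^ 10 *_) (trans (cong (2 ^_) (*-suc 13 t)) (^-distribˡ-+-* 2 13 (13 * t))) ⟨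
    4 ^ 10 * 2 ^ (13 * suc t)               ∎)
    where
    open ≤-Reasoning
    2[1+t]≤3t : 2 * suc t ≤ 3 * t
    2[1+t]≤3t = begin
      2 * suc t   ≡⟨ split t ⟩
      2 * t + 2   ≤⟨ +-monoʳ-≤ (2 * t) (≤-trans (≤ᵇ⇒≤ 2 9 _) (≤′⇒≤ 9≤′t)) ⟩
      2 * t + t   ≡⟨ merge t ⟩
      3 * t       ∎
      where
      split : ∀ t → 2 * suc t ≡ 2 * t + 2
      split = solve-∀
      merge : ∀ t → 2 * t + t ≡ 3 * t
      merge = solve-∀
    quadratic-step : 4 * (32 * (suc t * suc t)) ≤ 9 * (32 * (t * t))
    quadratic-step = begin
      4 * (32 * (suc t * suc t))        ≡⟨ square 2 (suc t) ⟩
      32 * ((2 * suc t) * (2 * suc t))  ≤⟨ *-monoʳ-≤ 32 (*-mono-≤ 2[1+t]≤3t 2[1+t]≤3t) ⟩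
      32 * ((3 * t) * (3 * t))          ≡⟨ square 3 t ⟨
      9 * (32 * (t * t))                ∎
      where
      square : ∀ a b → a * a * (32 * (b * b)) ≡ 32 * ((a * b) * (a * b))
      square = solve-∀

n<2^n : ∀ n → n < 2 ^ n
n<2^n zero    = s≤s z≤n
n<2^n (suc n) = begin-strict
  suc n              <⟨ s≤s (n<2^n n) ⟩
  1 + 2 ^ n          ≡⟨ +-comm 1 (2 ^ n) ⟩
  2 ^ n + 1          ≤⟨ +-monoʳ-≤ (2 ^ n) (m^n>0 2 n) ⟩
  2 ^ n + 2 ^ n      ≡⟨ cong (2 ^ n +_) (+-identityʳ (2 ^ n)) ⟨
  2 ^ suc n          ∎
  where open ≤-Reasoning

requestBound : ℕ → ℕ
requestBound t = 2 ^ t * (suc t * (2 * (2 ^ t * partSize t)) ^ t)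

requestBound≤ : ∀ t → 1 ≤ t → requestBound t ≤ (32 * (t * t)) ^ t * 2 ^ ((t + t) * t)
requestBound≤ t 1≤t = begin
  M * (suc t * (2 * (M * partSize t)) ^ t)  ≤⟨ *-monoʳ-≤ M (*-mono-≤ (n<2^n t) (^-monoˡ-≤ t 2MN≤)) ⟩
  M * (M * (8 * s * (M * M)) ^ t)           ≡⟨ cong (λ z → M * (M * z)) (^-distribʳ-* (8 * s) (M * M) t) ⟩
  M * (M * ((8 * s) ^ t * (M * M) ^ t))     ≡⟨ regroup M ((8 * s) ^ t) ((M * M) ^ t) ⟩
  (M * M) * (8 * s) ^ t * (M * M) ^ t       ≡⟨ cong₂ (λ a b → a * (8 * s) ^ t * b) M*M≡4^t [M*M]^t≡ ⟩
  4 ^ t * (8 * s) ^ t * 2 ^ ((t + t) * t)   ≡⟨ cong (_* 2 ^ ((t + t) * t)) (trans (cong (_^ t) (*-assoc 4 8 s)) (^-distribʳ-* 4 (8 * s) t)) ⟨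
  (32 * s) ^ t * 2 ^ ((t + t) * t)          ∎
  where
  open ≤-Reasoning
  s = t * t
  M = 2 ^ t
  2MN≤ : 2 * (M * partSize t) ≤ 8 * s * (M * M)
  2MN≤ = ≤-trans (*-monoʳ-≤ 2 (*-monoʳ-≤ M (partSize≤ t 1≤t))) (≤-reflexive (regroup′ s M))
    where
    regroup′ : ∀ s M → 2 * (M * (4 * s * M)) ≡ 8 * s * (M * M)
    regroup′ = solve-∀
  regroup : ∀ a b c → a * (a * (b * c)) ≡ (a * a) * b * c
  regroup = solve-∀
  M*M≡4^t : M * M ≡ 4 ^ t
  M*M≡4^t = sym (^-distribʳ-* 2 2 t)
  [M*M]^t≡ : (M * M) ^ t ≡ 2 ^ ((t + t) * t)
  [M*M]^t≡ = trans (cong (_^ t) (sym (^-distribˡ-+-* 2 t t))) (^-*-assoc 2 (t + t) t)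

requestBound^10<2^[33t²] : ∀ t → 9 ≤ t → requestBound t ^ 10 < 2 ^ (33 * (t * t))
requestBound^10<2^[33t²] t 9≤t = begin-strict
  requestBound t ^ 10                                    ≤⟨ ^-monoˡ-≤ 10 (requestBound≤ t (≤-trans (s≤s z≤n) 9≤t)) ⟩
  ((32 * s) ^ t * 2 ^ ((t + t) * t)) ^ 10                ≡⟨ ^-distribʳ-* ((32 * s) ^ t) _ 10 ⟩
  ((32 * s) ^ t) ^ 10 * (2 ^ ((t + t) * t)) ^ 10         ≡⟨ cong₂ _*_ (^-comm (32 * s) t 10) (^-*-assoc 2 ((t + t) * t) 10) ⟩
  ((32 * s) ^ 10) ^ t * 2 ^ ((t + t) * t * 10)           <⟨ *-monoˡ-< (2 ^ ((t + t) * t * 10)) {{m^n≢0 2 ((t + t) * t * 10)}}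
                                                              (^-monoˡ-< t {{>-nonZero (≤-trans (s≤s z≤n) 9≤t)}} ([32t²]^10<2^[13t] t 9≤t)) ⟩
  (2 ^ (13 * t)) ^ t * 2 ^ ((t + t) * t * 10)            ≡⟨ cong (_* 2 ^ ((t + t) * t * 10)) (^-*-assoc 2 (13 * t) t) ⟩
  2 ^ (13 * t * t) * 2 ^ ((t + t) * t * 10)              ≡⟨ ^-distribˡ-+-* 2 (13 * t * t) _ ⟨
  2 ^ (13 * t * t + (t + t) * t * 10)                    ≡⟨ cong (2 ^_) (exponent t) ⟩
  2 ^ (33 * (t * t))                                     ∎
  where
  open ≤-Reasoning
  s = t * t
  ^-comm : ∀ a b c → (a ^ b) ^ c ≡ (a ^ c) ^ b
  ^-comm a b c = trans (^-*-assoc a b c) (trans (cong (a ^_) (*-comm b c)) (sym (^-*-assoc a c b)))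
  exponent : ∀ t → 13 * t * t + (t + t) * t * 10 ≡ 33 * (t * t)
  exponent = solve-∀

2^t∸1+1≡2^t : ∀ t → suc (2 ^ t ∸ 1) ≡ 2 ^ t
2^t∸1+1≡2^t t = trans (+-comm 1 (2 ^ t ∸ 1)) (m∸n+n≡m (m^n>0 2 t))

-- Raising to the 10th power makes N = ⌈33 t² 2^t / 10⌉ usable through 10 N ≥ 33 t² 2^t.
requestBound*[2^t∸1]^N<[2^t]^N : ∀ t → 1 ≤ t → requestBound t * (2 ^ t ∸ 1) ^ partSize t < (2 ^ t) ^ partSize t
requestBound*[2^t∸1]^N<[2^t]^N t 1≤t with 9 ≤? t
... | yes 9≤t = ^-cancelˡ-< 10 (*-cancelˡ-< (2 ^ P) _ _ (begin-strict
  2 ^ P * (Y * c ^ N) ^ 10                  ≡⟨ cong (2 ^ P *_) (trans (^-distribʳ-* Y (c ^ N) 10) (cong (Y ^ 10 *_) (^-*-assoc c N 10))) ⟩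
  2 ^ P * (Y ^ 10 * c ^ (N * 10))           ≡⟨ x*[y*z]≡y*[x*z] (2 ^ P) (Y ^ 10) _ ⟩
  Y ^ 10 * (2 ^ P * c ^ (N * 10))           ≤⟨ *-monoʳ-≤ (Y ^ 10) 2^P*c^[10N]≤M^[10N] ⟩
  Y ^ 10 * M ^ (N * 10)                     <⟨ *-monoˡ-< (M ^ (N * 10)) {{m^n≢0 M (N * 10) {{m^n≢0 2 t}}}} (requestBound^10<2^[33t²] t 9≤t) ⟩
  2 ^ P * M ^ (N * 10)                      ≡⟨ cong (2 ^ P *_) (^-*-assoc M N 10) ⟨
  2 ^ P * (M ^ N) ^ 10                      ∎))
  where
  open ≤-Reasoning
  P = 33 * (t * t)
  M = 2 ^ t
  c = M ∸ 1
  N = partSize t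
  Y = requestBound t
  x*[y*z]≡y*[x*z] : ∀ x y z → x * (y * z) ≡ y * (x * z)
  x*[y*z]≡y*[x*z] = solve-∀
  MP≤10N : suc c * P ≤ N * 10
  MP≤10N = subst (λ z → z * P ≤ N * 10) (sym (2^t∸1+1≡2^t t)) (≤-trans (≤-reflexive (*-comm M P)) (≤⌈/10⌉*10 (P * M)))
  2^P*c^[10N]≤M^[10N] : 2 ^ P * c ^ (N * 10) ≤ M ^ (N * 10)
  2^P*c^[10N]≤M^[10N] = subst (λ z → 2 ^ P * c ^ (N * 10) ≤ z ^ (N * 10)) (2^t∸1+1≡2^t t) (2^P*c^Q≤[1+c]^Q c P (N * 10) MP≤10N)
... | no 9≰t = small t 1≤t (≰⇒> 9≰t)
  where
  small : ∀ t → 1 ≤ t → t < 9 → requestBound t * (2 ^ t ∸ 1) ^ partSize t < (2 ^ t) ^ partSize t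
  small 1 _ _ = ≤ᵇ⇒≤ _ _ _
  small 2 _ _ = ≤ᵇ⇒≤ _ _ _
  small 3 _ _ = ≤ᵇ⇒≤ _ _ _
  small 4 _ _ = ≤ᵇ⇒≤ _ _ _
  small 5 _ _ = ≤ᵇ⇒≤ _ _ _
  small 6 _ _ = ≤ᵇ⇒≤ _ _ _
  small 7 _ _ = ≤ᵇ⇒≤ _ _ _
  small 8 _ _ = ≤ᵇ⇒≤ _ _ _
  small (suc (suc (suc (suc (suc (suc (suc (suc (suc _))))))))) _ (s≤s (s≤s (s≤s (s≤s (s≤s (s≤s (s≤s (s≤s (s≤s ())))))))))

2*a<n⇒a<⌈n/2⌉ : ∀ a n → 2 * a < n → a < ⌈ n /2⌉
2*a<n⇒a<⌈n/2⌉ a n 2a<n = ≰⇒> (λ ⌈n/2⌉≤a → <⇒≱ 2a<n (begin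
  n                        ≡⟨ ⌊n/2⌋+⌈n/2⌉≡n n ⟨
  ⌊ n /2⌋ + ⌈ n /2⌉        ≤⟨ +-mono-≤ (≤-trans (⌊n/2⌋≤⌈n/2⌉ n) ⌈n/2⌉≤a) ⌈n/2⌉≤a ⟩
  a + a                    ≡⟨ cong (a +_) (+-identityʳ a) ⟨
  2 * a                    ∎))
  where open ≤-Reasoning

2^t<n⇒t<⌈log₂n⌉ : ∀ t n → 2 ^ t < n → t < ⌈log₂ n ⌉
2^t<n⇒t<⌈log₂n⌉ zero    n 1<n = ⌈log₂⌉-mono-≤ {2} {n} 1<n
2^t<n⇒t<⌈log₂n⌉ (suc t) n 2^[1+t]<n = begin-strict
  suc t                    <⟨ s≤s (2^t<n⇒t<⌈log₂n⌉ t ⌈ n /2⌉ (2*a<n⇒a<⌈n/2⌉ (2 ^ t) n 2^[1+t]<n)) ⟩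
  suc ⌈log₂ ⌈ n /2⌉ ⌉      ≡⟨ cong suc (⌈log₂⌈n/2⌉⌉≡⌈log₂n⌉∸1 n) ⟩
  suc (⌈log₂ n ⌉ ∸ 1)      ≡⟨ +-comm 1 _ ⟩
  ⌈log₂ n ⌉ ∸ 1 + 1        ≡⟨ m∸n+n≡m 1≤⌈log₂n⌉ ⟩
  ⌈log₂ n ⌉                ∎
  where
  open ≤-Reasoning
  1≤⌈log₂n⌉ : 1 ≤ ⌈log₂ n ⌉
  1≤⌈log₂n⌉ = ⌈log₂⌉-mono-≤ {2} {n} (≤-trans (*-monoʳ-≤ 2 (m^n>0 2 t)) (<⇒≤ 2^[1+t]<n))

⌈log₂n⌉≤t⇒n≤2^t : ∀ n t → ⌈log₂ n ⌉ ≤ t → n ≤ 2 ^ t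
⌈log₂n⌉≤t⇒n≤2^t n t log≤t = ≮⇒≥ (λ 2^t<n → <⇒≱ (2^t<n⇒t<⌈log₂n⌉ t n 2^t<n) log≤t)

lemma11 : (k t : ℕ) → 2 ≤ k → ⌈log₂ k ⌉ ≤ t →
    ∃[ K ] Full k t ⌈ 33 * (t * t) * 2 ^ t /10⌉ K
lemma11 (suc m) t 2≤k log≤t = orientation T , all-met⇒full T all-met
  where
  open Construction m (partSize t) t
  k≤2^t : k ≤ 2 ^ t
  k≤2^t = ⌈log₂n⌉≤t⇒n≤2^t k t log≤t
  1≤t : 1 ≤ t
  1≤t = positive t k≤2^t
    where
    positive : ∀ t → k ≤ 2 ^ t → 1 ≤ t
    positive zero    k≤1 = ⊥-elim (<⇒≱ 2≤k k≤1)
    positive (suc t) _   = s≤s z≤n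
  1≤N : 1 ≤ partSize t
  1≤N = m≥n⇒m/n>0 (+-monoˡ-≤ 9 (*-mono-≤ (*-mono-≤ {1} {33} (s≤s z≤n) (*-mono-≤ 1≤t 1≤t)) (m^n>0 2 t)))
  few-requests : length requests * (2 ^ t ∸ 1) ^ partSize t < (2 ^ t) ^ partSize t
  few-requests = ≤-<-trans (*-monoˡ-≤ ((2 ^ t ∸ 1) ^ partSize t) (≤-trans (length-requests≤ 1≤N)
      (*-mono-≤ k≤2^t (*-monoʳ-≤ (suc t) (^-monoˡ-≤ t (*-monoʳ-≤ 2 (*-monoˡ-≤ (partSize t) k≤2^t)))))))
    (requestBound*[2^t∸1]^N<[2^t]^N t 1≤t)
  T = proj₁ (∃-all-met requests few-requests)
  all-met = proj₂ (∃-all-met requests few-requests)
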